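{- Let $(T,L)$ be a shadow-complete $k$-wide TAP instance and $(x,\lambda)$ a feasible solution of the $k$-wide-LP. Then $x(L_{\mathrm{up}})\ge x(L^{\mathrm{no\text{ - }crit}}_{\mathrm{cross}})$.
   Context: TAP instance $(T,L)$: tree $T=(V,E)$, links $L\subseteq\binom V2$; $P_\ell$ is the edge set of the path between the endpoints of $\ell$. $\mathrm{cov}(F)=\{\ell: P_\ell\cap F\ne\emptyset\}$; $x(S)=\sum_{\ell\in S}x_\ell$. $T$ is $k$-wide with root $r$: each principal subtree $T_i=(V_i,E_i)$, $i\in[q]$ ($r$, a child of $r$, and all its descendants) has at most $k$ leaves. Cross-links $L_{\mathrm{cross}}$: links with both endpoints $\ne r$ in different principal subtrees; in-links $L_{\mathrm{in}}$: links with both endpoints in the same principal subtree; up-links $L_{\mathrm{up}}\subseteq L_{\mathrm{in}}$: in-links $\{u,v\}$ such that one endpoint lies on the path from $r$ to the other. $V_{\mathrm{crit}}$: vertices $\ne r$ with degree $\ne2$ in $T$; $L^{\mathrm{no\text{ - }crit}}_{\mathrm{cross}}$: cross-links having at least one endpoint not in $V_{\mathrm{crit}}$. Shadow-complete: for all $\ell$ and distinct $u,v$ on $P_\ell$, $\{u,v\}\in L$ (a shadow of $\ell$). Links $\ell_1,\ell_2$ are shadow-minimal if no shadow $s$ (different from the link itself) of one, say $\ell_1$, has $P_{\ell_1}\cup P_{\ell_2}=P_s\cup P_{\ell_2}$; a set is shadow-minimal if pairwise so. $\Pi_T^{\mathrm{CG}}$: all $x\in[0,1]^L$ with $x(\pi(S))\ge(|\delta_E(S)|+1)/2$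 for every $S\subseteq V$ with $|\delta_E(S)|$ odd, where $\delta_E(S)$ are the edges with exactly one endpoint in $S$ and $\pi(S)$ is the multiset of links $\ell$ with $P_\ell\cap\delta_E(S)\ne\emptyset$, with multiplicity $\lceil|P_\ell\cap\delta_E(S)|/2\rceil$. $\Lambda_i$: all shadow-minimal sets of cross-links each having an endpoint in $V_i$; for $R\in\Lambda_i$, $C(i,R)$ is a minimum-cardinality set of links with both endpoints in $V_i$ such that $R\cup C(i,R)$ is shadow-minimal and covers $E_i$; $L_i^R=R\cup C(i,R)$. The $k$-wide-LP: variables $x\in\mathbb{R}^L$, $\lambda_i^R$ ($i\in[q]$, $R\in\Lambda_i$); constraints $x\in\Pi_T^{\mathrm{CG}}$, $x_\ell=\sum_{R\in\Lambda_i:\ell\in L_i^R}\lambda_i^R$ for all $i$ and $\ell\in\mathrm{cov}(E_i)$, $\sum_{R\in\Lambda_i}\lambda_i^R=1$ for all $i$, $\lambda\ge0$; objective: minimize $x(L)$.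
   Formalization: The feasible solution $(x,\lambda)$ of the k-wide-LP takes rational values rather than real ones. -}

module Defs where

open import Data.Nat as ℕ using (ℕ; zero; suc; ⌈_/2⌉)

open import Data.Integer using (+_)
open import Data.Rational as ℚ using (ℚ; 0ℚ; 1ℚ; _/_)
open import Data.Fin using (Fin; zero; suc; toℕ)
open import Data.Fin.Subset using (Subset; _∈_; _∉_; _∪_; ∣_∣)
open import Data.Bool using (Bool; true; false; _∧_; _∨_; _xor_; not; if_then_else_)
open import Data.List using (List; upTo; allFin; filterᵇ; length)
open import Data.Bool.ListAction using (any)
open import Data.Vec using (Vec; []; _∷_; lookup)
open import Data.Product using (Σ; ∃; _×_; _,_; proj₁; proj₂)
open import Data.Sum using (_⊎_)
open import Relation.Nullary using (¬_; does)
open import Relation.Binary.PropositionalEquality using (_≡_; _≢_)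

sumFin : (m : ℕ) → (Fin m → ℚ) → ℚ
sumFin zero    f = 0ℚ
sumFin (suc m) f = f zero ℚ.+ sumFin m (λ i → f (suc i))

sumSubsets : (m : ℕ) → (Subset m → ℚ) → ℚ
sumSubsets zero    f = f []
sumSubsets (suc m) f = sumSubsets m (λ s → f (false ∷ s)) ℚ.+ sumSubsets m (λ s → f (true ∷ s))

countFin : (m : ℕ) → (Fin m → Bool) → ℕ
countFin m p = length (filterᵇ p (allFin m))

ℕtoℚ : ℕ → ℚ
ℕtoℚ k = (+ k) / 1

-- Rooted tree on vertices Fin (suc n), root = zero.
-- parent i is the parent of the vertex (suc i); the tree edge e_i is
-- {suc i , parent i}.  ParentOK: parent has smaller index (so T is a tree).

ParentOK : {n : ℕ} → (Fin n → Fin (suc n)) → Set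
ParentOK {n} parent = ∀ i → toℕ (parent i) ℕ.≤ toℕ i

-- Links: Fin m indexes L; lk ℓ = endpoints.  Endpoints distinct, and
-- no two indices give the same unordered pair (L is a set).
SamePair : {n : ℕ} → Fin (suc n) × Fin (suc n) → Fin (suc n) × Fin (suc n) → Set
SamePair (a , b) (c , d) = (a ≡ c × b ≡ d) ⊎ (a ≡ d × b ≡ c)

LinksOK : {n m : ℕ} → (Fin m → Fin (suc n) × Fin (suc n)) → Set
LinksOK {n} {m} lk =
  (∀ ℓ → proj₁ (lk ℓ) ≢ proj₂ (lk ℓ)) ×
  (∀ ℓ ℓ' → SamePair (lk ℓ) (lk ℓ') → ℓ ≡ ℓ')

module TAP {n m : ℕ} (parent : Fin n → Fin (suc n))
           (lk : Fin m → Fin (suc n) × Fin (suc n)) where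

  V = Fin (suc n)
  Link = Fin m

  _==_ : V → V → Bool
  u == v = does (u Data.Fin.≟ v)
    where import Data.Fin

  par : V → V
  par zero    = zero
  par (suc i) = parent i

  up : ℕ → V → V
  up zero    v = v
  up (suc j) v = up j (par v)

  -- a lies on the path from the root r to v (a = v allowed)
  anc : V → V → Bool
  anc a v = any (λ j → up j v == a) (upTo (suc n))

  nonroot : V → Bool
  nonroot zero    = false
  nonroot (suc _) = true

  -- edge e_i lies on the tree path between a and b
  onPathE : V → V → Fin n → Bool
  onPathE a b i = anc (suc i) a xor anc (suc i) b

  P : Link → Fin n → Bool
  P ℓ = onPathE (proj₁ (lk ℓ)) (proj₂ (lk ℓ))

  -- vertex w lies on P_ℓ (links have distinct endpoints, so w is on the
  -- path iff it is an endpoint of an edge of P_ℓ)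
  OnPathV : Link → V → Set
  OnPathV ℓ w = Σ (Fin n) λ i → P ℓ i ≡ true × (w ≡ suc i ⊎ w ≡ parent i)

  ShadowComplete : Set
  ShadowComplete = ∀ ℓ u v → u ≢ v → OnPathV ℓ u → OnPathV ℓ v →
                   Σ Link λ s → SamePair (lk s) (u , v)

  IsShadow : Link → Link → Set
  IsShadow s ℓ = OnPathV ℓ (proj₁ (lk s)) × OnPathV ℓ (proj₂ (lk s))

  NoReplace : Link → Link → Set
  NoReplace ℓ₁ ℓ₂ = ¬ (Σ Link λ s → IsShadow s ℓ₁ × s ≢ ℓ₁ ×
                        (∀ e → (P ℓ₁ e ∨ P ℓ₂ e) ≡ (P s e ∨ P ℓ₂ e)))

  ShadowMinimalPair : Link → Link → Set
  ShadowMinimalPair ℓ₁ ℓ₂ = NoReplace ℓ₁ ℓ₂ × NoReplace ℓ₂ ℓ₁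

  ShadowMinimal : Subset m → Set
  ShadowMinimal R = ∀ ℓ₁ ℓ₂ → ℓ₁ ∈ R → ℓ₂ ∈ R → ℓ₁ ≢ ℓ₂ → ShadowMinimalPair ℓ₁ ℓ₂

  -- children of the root index the principal subtrees
  IsChild : V → Set
  IsChild c = Σ (Fin n) λ i → c ≡ suc i × parent i ≡ zero

  -- u ∈ V_c  (root plus c and its descendants)
  inV : V → V → Bool
  inV c u = not (nonroot u) ∨ anc c u

  inE : V → Fin n → Bool
  inE c i = anc c (suc i)

  sameSub : V → V → Bool
  sameSub u v = any (λ w → anc (suc w) u ∧ anc (suc w) v) (allFin n)

  crossB : Link → Bool
  crossB ℓ = nonroot u ∧ nonroot v ∧ not (sameSub u v)
    where u = proj₁ (lk ℓ) ; v = proj₂ (lk ℓ)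

  inB : Link → Bool
  inB ℓ = not (nonroot u) ∨ not (nonroot v) ∨ sameSub u v
    where u = proj₁ (lk ℓ) ; v = proj₂ (lk ℓ)

  upB : Link → Bool
  upB ℓ = inB ℓ ∧ (anc u v ∨ anc v u)
    where u = proj₁ (lk ℓ) ; v = proj₂ (lk ℓ)

  numChildren : V → ℕ
  numChildren v = countFin n (λ i → parent i == v)

  deg : V → ℕ
  deg v = numChildren v ℕ.+ (if nonroot v then 1 else 0)

  critB : V → Bool
  critB v = nonroot v ∧ not (does (deg v Data.Nat.≟ 2))
    where import Data.Nat

  crossNoCritB : Link → Bool
  crossNoCritB ℓ = crossB ℓ ∧ (not (critB u) ∨ not (critB v))
    where u = proj₁ (lk ℓ) ; v = proj₂ (lk ℓ)

  leavesIn : V → ℕ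
  leavesIn c = countFin (suc n) (λ v → nonroot v ∧ anc c v ∧ does (numChildren v Data.Nat.≟ 0))
    where import Data.Nat

  KWide : ℕ → Set
  KWide k = ∀ c → IsChild c → leavesIn c ℕ.≤ k

  xsum : (Link → ℚ) → (Link → Bool) → ℚ
  xsum x p = sumFin m (λ ℓ → if p ℓ then x ℓ else 0ℚ)

  δ : Subset (suc n) → Fin n → Bool
  δ S i = lookup S (suc i) xor lookup S (parent i)

  InCG : (Link → ℚ) → Set
  InCG x = (∀ ℓ → 0ℚ ℚ.≤ x ℓ × x ℓ ℚ.≤ 1ℚ) ×
           (∀ (S : Subset (suc n)) → countFin n (δ S) ℕ.% 2 ≡ 1 →
              (+ (countFin n (δ S) ℕ.+ 1)) / 2
                ℚ.≤ sumFin m (λ ℓ → ℕtoℚ ⌈ countFin n (λ i → P ℓ i ∧ δ S i) /2⌉ ℚ.* x ℓ))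

  InΛ : V → Subset m → Set
  InΛ c R = (∀ ℓ → ℓ ∈ R → crossB ℓ ≡ true ×
                 (inV c (proj₁ (lk ℓ)) ≡ true ⊎ inV c (proj₂ (lk ℓ)) ≡ true))
            × ShadowMinimal R

  ValidC : V → Subset m → Subset m → Set
  ValidC c R C =
    (∀ ℓ → ℓ ∈ C → inV c (proj₁ (lk ℓ)) ≡ true × inV c (proj₂ (lk ℓ)) ≡ true) ×
    ShadowMinimal (R ∪ C) ×
    (∀ i → inE c i ≡ true → Σ Link λ ℓ → ℓ ∈ (R ∪ C) × P ℓ i ≡ true)

  IsCChoice : (V → Subset m → Subset m) → Set
  IsCChoice C = ∀ c → IsChild c → ∀ R → InΛ c R →
                ValidC c R (C c R) × (∀ C' → ValidC c R C' → ∣ C c R ∣ ℕ.≤ ∣ C' ∣)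

  InCov : V → Link → Set
  InCov c ℓ = Σ (Fin n) λ i → P ℓ i ≡ true × inE c i ≡ true

  memB : Link → Subset m → Bool
  memB ℓ S = lookup S ℓ

  -- feasibility for the k-wide-LP; λ c R is λ_c^R, extended by 0 outside Λ_c
  record Feasible (C : V → Subset m → Subset m) (x : Link → ℚ) (lam : V → Subset m → ℚ) : Set where
    field
      cg      : InCG x
      lamNonneg : ∀ c R → 0ℚ ℚ.≤ lam c R
      lamSupp : ∀ c R → ¬ InΛ c R → lam c R ≡ 0ℚ
      lamSum  : ∀ c → IsChild c → sumSubsets m (lam c) ≡ 1ℚ
      lamCons : ∀ c → IsChild c → ∀ ℓ → InCov c ℓ →
                x ℓ ≡ sumSubsets m (λ R → if memB ℓ (R ∪ C c R) then lam c R else 0ℚ)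

-- Charge the cross-links at a non-critical vertex u ≠ r to the up-links whose top is u.  Such a u
-- has a single child w, and both kinds of links lie in cov(E_c) for the principal subtree c of u, so
-- the λ-constraints write both weights as the same convex combination over the sets L_c^R.  In a
-- shadow-minimal L_c^R at most one cross-link ends at u (two of them could trade one for its shadow
-- through r), and if one does, the link of L_c^R covering the edge above w is an up-link ending at u:
-- otherwise it would also cover the edge above u, and the cross-link could be shortened to its shadow
-- starting at the parent of u.  Summing over non-critical u, every link of L_cross^no-crit is charged
-- from one of its endpoints and every up-link is hit at most once, namely at its top.
module Submission where

open import Defs
open import Data.Nat using (ℕ; suc)
open import Data.Fin using (Fin)
open import Data.Fin.Subset using (Subset)
open import Data.Product using (_×_)
open import Data.Rational using (ℚ; _≤_)

open import Algebra.Bundles using (CommutativeMonoid)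
open import Data.Bool using (Bool; true; false; if_then_else_; _∧_; _∨_; not; _xor_)
open import Data.Bool.ListAction using (any)
open import Data.Bool.Properties using (_≟_; ∧-conicalˡ; ∧-conicalʳ; ∨-zeroʳ; xor-comm; not-¬; not-involutive)
open import Data.Empty using (⊥; ⊥-elim)
open import Data.Fin as Fin using (zero; suc; toℕ)
import Data.Fin.Properties as Finₚ
open import Data.Fin.Subset using (_∈_; _∪_)
open import Data.List using (_∷_; tabulate; filterᵇ; length; upTo)
open import Data.List.Membership.Propositional using () renaming (_∈_ to _∈ˡ_)
open import Data.List.Membership.Propositional.Properties using (∈-upTo⁺; ∈-allFin)
open import Data.List.Relation.Unary.Any using (here; there)
open import Data.Nat as ℕ using (zero; z≤n; s≤s)
import Data.Nat.Properties as ℕₚ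
open import Data.Product using (Σ; ∃; ∃₂; _,_; proj₁; proj₂)
open import Data.Rational using (0ℚ; _+_; _≤?_)
open import Data.Rational.Properties as ℚₚ
  using (≤-refl; ≤-trans; ≤-reflexive; +-mono-≤; +-identityʳ; +-identityˡ; module ≤-Reasoning)
open import Data.Sum using (_⊎_; inj₁; inj₂; [_,_])
open import Data.Vec using (_∷_)
open import Data.Vec.Properties using (lookup⇒[]=; []=⇒lookup)
open import Function using (_∘_; const)
open import Relation.Nullary using (¬_; Dec; yes; no; does)
open import Relation.Nullary.Decidable using (dec-true; decidable-stable)
open import Relation.Binary.PropositionalEquality using (_≡_; _≢_; _≗_; refl; sym; trans; cong; cong₂; subst)

open import Algebra.Properties.CommutativeSemigroup
  (CommutativeMonoid.commutativeSemigroup ℚₚ.+-0-commutativeMonoid) using (interchange)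

does-true⇒ : ∀ {p} {P : Set p} (P? : Dec P) → does P? ≡ true → P
does-true⇒ (yes p) _ = p

∨-true⁻ : ∀ {a b} → a ∨ b ≡ true → a ≡ true ⊎ b ≡ true
∨-true⁻ {true}  _ = inj₁ refl
∨-true⁻ {false} e = inj₂ e

∨-introʳ : ∀ a {b} → b ≡ true → a ∨ b ≡ true
∨-introʳ a b≡true = trans (cong (a ∨_) b≡true) (∨-zeroʳ a)

xor-true⁻ : ∀ a b → a xor b ≡ true → (a ≡ true × b ≡ false) ⊎ (a ≡ false × b ≡ true)
xor-true⁻ true  false _ = inj₁ (refl , refl)
xor-true⁻ false true  _ = inj₂ (refl , refl)

module _ {A : Set} where

  any-true⁺ : ∀ (p : A → Bool) {x xs} → x ∈ˡ xs → p x ≡ true → any p xs ≡ true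
  any-true⁺ p {xs = _ ∷ xs} (here refl) px = cong (_∨ any p xs) px
  any-true⁺ p (there x∈xs) px = ∨-introʳ _ (any-true⁺ p x∈xs px)

  any-true⁻ : ∀ (p : A → Bool) xs → any p xs ≡ true → ∃ λ x → x ∈ˡ xs × p x ≡ true
  any-true⁻ p (x ∷ xs) e with ∨-true⁻ e
  ... | inj₁ px   = x , here refl , px
  ... | inj₂ rest = let y , y∈xs , py = any-true⁻ p xs rest in y , there y∈xs , py

  filter-tabulate-nonempty : ∀ {n} (g : Fin n → A) (p : A → Bool) {i} → p (g i) ≡ true →
                             0 ℕ.< length (filterᵇ p (tabulate g))
  filter-tabulate-nonempty g p {zero}  pgi rewrite pgi = s≤s z≤n
  filter-tabulate-nonempty g p {suc i} pgi with p (g zero)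
  ... | true  = s≤s z≤n
  ... | false = filter-tabulate-nonempty (g ∘ suc) p pgi

  filter-tabulate-witness : ∀ {n} (g : Fin n → A) (p : A → Bool) →
                            0 ℕ.< length (filterᵇ p (tabulate g)) → ∃ λ i → p (g i) ≡ true
  filter-tabulate-witness {suc n} g p nonempty with p (g zero) in pg0
  ... | true  = zero , pg0
  ... | false = let i , pgi = filter-tabulate-witness (g ∘ suc) p nonempty in suc i , pgi

  filter-tabulate-only-head : ∀ {n} (g : Fin n → A) (p : A → Bool) →
                              suc (length (filterᵇ p (tabulate g))) ≡ 1 → ∀ {i} → p (g i) ≢ true
  filter-tabulate-only-head g p single pgi =
    ℕₚ.<-irrefl (sym (ℕₚ.suc-injective single)) (filter-tabulate-nonempty g p pgi)

  filter-tabulate-single : ∀ {n} (g : Fin n → A) (p : A → Bool) →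
                           length (filterᵇ p (tabulate g)) ≡ 1 →
                           ∀ {i j} → p (g i) ≡ true → p (g j) ≡ true → i ≡ j
  filter-tabulate-single g p single {zero}  {zero}  _   _   = refl
  filter-tabulate-single g p single {zero}  {suc j} pg0 pgj rewrite pg0 =
    ⊥-elim (filter-tabulate-only-head (g ∘ suc) p single pgj)
  filter-tabulate-single g p single {suc i} {zero}  pgi pg0 rewrite pg0 =
    ⊥-elim (filter-tabulate-only-head (g ∘ suc) p single pgi)
  filter-tabulate-single g p single {suc i} {suc j} pgi pgj with p (g zero)
  ... | true  = ⊥-elim (filter-tabulate-only-head (g ∘ suc) p single pgi)
  ... | false = cong suc (filter-tabulate-single (g ∘ suc) p single pgi pgj)

when : Bool → ℚ → ℚ
when b a = if b then a else 0ℚ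

when-zero : ∀ b → when b 0ℚ ≡ 0ℚ
when-zero true  = refl
when-zero false = refl

when-nonneg : ∀ b {a} → 0ℚ ≤ a → 0ℚ ≤ when b a
when-nonneg true  0≤a = 0≤a
when-nonneg false _   = ≤-refl

sumFin-cong : ∀ {m} {f g : Fin m → ℚ} → f ≗ g → sumFin m f ≡ sumFin m g
sumFin-cong {zero}  f≗g = refl
sumFin-cong {suc m} f≗g = cong₂ _+_ (f≗g zero) (sumFin-cong (f≗g ∘ suc))

sumFin-zero : ∀ {m} {f : Fin m → ℚ} → f ≗ const 0ℚ → sumFin m f ≡ 0ℚ
sumFin-zero {zero}  _   = refl
sumFin-zero {suc m} f≗0 = cong₂ _+_ (f≗0 zero) (sumFin-zero (f≗0 ∘ suc))

sumFin-+ : ∀ {m} (f g : Fin m → ℚ) → sumFin m (λ i → f i + g i) ≡ sumFin m f + sumFin m g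
sumFin-+ {zero}  f g = sym (+-identityʳ 0ℚ)
sumFin-+ {suc m} f g =
  trans (cong (f zero + g zero +_) (sumFin-+ (f ∘ suc) (g ∘ suc)))
        (interchange (f zero) (g zero) (sumFin m (f ∘ suc)) (sumFin m (g ∘ suc)))

sumFin-comm : ∀ {m k} (f : Fin m → Fin k → ℚ) →
              sumFin m (λ i → sumFin k (f i)) ≡ sumFin k (λ j → sumFin m (λ i → f i j))
sumFin-comm {m} {zero}  f = sumFin-zero {m} (λ _ → refl)
sumFin-comm {m} {suc k} f =
  trans (sumFin-+ (λ i → f i zero) (λ i → sumFin k (λ j → f i (suc j))))
        (cong (sumFin m (λ i → f i zero) +_) (sumFin-comm (λ i j → f i (suc j))))

sumFin-sumSubsets-comm : ∀ {m k} (f : Fin m → Subset k → ℚ) →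
                         sumFin m (λ i → sumSubsets k (f i)) ≡ sumSubsets k (λ R → sumFin m (λ i → f i R))
sumFin-sumSubsets-comm {k = zero}  f = refl
sumFin-sumSubsets-comm {m} {suc k} f =
  trans (sumFin-+ (λ i → sumSubsets k (λ R → f i (false ∷ R))) (λ i → sumSubsets k (λ R → f i (true ∷ R))))
  (cong₂ _+_ (sumFin-sumSubsets-comm (λ i R → f i (false ∷ R)))
             (sumFin-sumSubsets-comm (λ i R → f i (true ∷ R))))

sumSubsets-zero : ∀ {m} {f : Subset m → ℚ} → f ≗ const 0ℚ → sumSubsets m f ≡ 0ℚ
sumSubsets-zero {zero}  f≗0 = f≗0 _
sumSubsets-zero {suc m} f≗0 =
  cong₂ _+_ (sumSubsets-zero (λ R → f≗0 (false ∷ R))) (sumSubsets-zero (λ R → f≗0 (true ∷ R)))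

sumSubsets-mono : ∀ {m} {f g : Subset m → ℚ} → (∀ R → f R ≤ g R) → sumSubsets m f ≤ sumSubsets m g
sumSubsets-mono {zero}  f≤g = f≤g _
sumSubsets-mono {suc m} f≤g =
  +-mono-≤ (sumSubsets-mono (λ R → f≤g (false ∷ R))) (sumSubsets-mono (λ R → f≤g (true ∷ R)))

sumFin-when-∧ : ∀ b {m} (q : Fin m → Bool) (f : Fin m → ℚ) →
                sumFin m (λ i → when (b ∧ q i) (f i)) ≡ when b (sumFin m (λ i → when (q i) (f i)))
sumFin-when-∧ true  q f = refl
sumFin-when-∧ false {m} q f = sumFin-zero {m} (λ _ → refl)

sumFin-mono : ∀ {m} {f g : Fin m → ℚ} → (∀ i → f i ≤ g i) → sumFin m f ≤ sumFin m g
sumFin-mono {zero}  f≤g = ≤-refl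
sumFin-mono {suc m} f≤g = +-mono-≤ (f≤g zero) (sumFin-mono (f≤g ∘ suc))

sumFin-nonneg : ∀ {m} {f : Fin m → ℚ} → (∀ i → 0ℚ ≤ f i) → 0ℚ ≤ sumFin m f
sumFin-nonneg {m} {f} 0≤f = subst (_≤ sumFin m f) (sumFin-zero {m} (λ _ → refl)) (sumFin-mono 0≤f)

term≤sumFin : ∀ {m} {f : Fin m → ℚ} → (∀ i → 0ℚ ≤ f i) → ∀ j → f j ≤ sumFin m f
term≤sumFin {suc m} {f} 0≤f zero = begin
  f zero                         ≡⟨ sym (+-identityʳ (f zero)) ⟩
  f zero + 0ℚ                    ≤⟨ ℚₚ.+-monoʳ-≤ (f zero) (sumFin-nonneg (0≤f ∘ suc)) ⟩
  f zero + sumFin m (f ∘ suc)    ∎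
  where open ≤-Reasoning
term≤sumFin {suc m} {f} 0≤f (suc j) = begin
  f (suc j)                      ≤⟨ term≤sumFin (0≤f ∘ suc) j ⟩
  sumFin m (f ∘ suc)             ≡⟨ sym (+-identityˡ _) ⟩
  0ℚ + sumFin m (f ∘ suc)        ≤⟨ ℚₚ.+-monoˡ-≤ (sumFin m (f ∘ suc)) (0≤f zero) ⟩
  f zero + sumFin m (f ∘ suc)    ∎
  where open ≤-Reasoning

≤-sumFin-when : ∀ {m} (q : Fin m → Bool) {a} → 0ℚ ≤ a → ∀ {j} → q j ≡ true →
                a ≤ sumFin m (λ i → when (q i) a)
≤-sumFin-when q {a} 0≤a {j} qj =
  subst (_≤ _) (cong (λ b → when b a) qj) (term≤sumFin (λ i → when-nonneg (q i) 0≤a) j)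

sumFin-when-≤ : ∀ {m} (q : Fin m → Bool) {a} → 0ℚ ≤ a → (∀ {i j} → q i ≡ true → q j ≡ true → i ≡ j) →
                sumFin m (λ i → when (q i) a) ≤ a
sumFin-when-≤ {zero}  q 0≤a _ = 0≤a
sumFin-when-≤ {suc m} q {a} 0≤a unique with q zero in q0
... | true  = ≤-reflexive (trans (cong (a +_) (sumFin-zero vanish)) (+-identityʳ a))
  where
  vanish : ∀ i → when (q (suc i)) a ≡ 0ℚ
  vanish i with q (suc i) in qi
  ... | true  = ⊥-elim (Finₚ.0≢1+n (unique q0 qi))
  ... | false = refl
... | false = subst (_≤ a) (sym (+-identityˡ _))
  (sumFin-when-≤ (q ∘ suc) 0≤a (λ qi qj → Finₚ.suc-injective (unique qi qj)))

sumFin-when-compare : ∀ {m} (q q' : Fin m → Bool) {a} → 0ℚ ≤ a →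
                      (∀ {i j} → q i ≡ true → q j ≡ true → i ≡ j) →
                      (∀ {i} → q i ≡ true → ∃ λ j → q' j ≡ true) →
                      sumFin m (λ i → when (q i) a) ≤ sumFin m (λ i → when (q' i) a)
sumFin-when-compare q q' {a} 0≤a unique q⇒q' with Finₚ.any? (λ i → q i ≟ true)
... | yes (i , qi) = ≤-trans (sumFin-when-≤ q 0≤a unique) (≤-sumFin-when q' 0≤a (proj₂ (q⇒q' qi)))
... | no none = subst (_≤ _) (sym (sumFin-zero vanish)) (sumFin-nonneg (λ i → when-nonneg (q' i) 0≤a))
  where
  vanish : ∀ i → when (q i) a ≡ 0ℚ
  vanish i with q i in qi
  ... | true  = ⊥-elim (none (i , qi))
  ... | false = refl

module Ancestry {n m : ℕ} (parent : Fin n → Fin (suc n)) (parent< : ParentOK parent)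
                (lk : Fin m → Fin (suc n) × Fin (suc n)) where

  open TAP parent lk

  ==⇒≡ : ∀ {u v : V} → (u == v) ≡ true → u ≡ v
  ==⇒≡ {u} {v} = does-true⇒ (u Fin.≟ v)

  ≡⇒== : ∀ {u v : V} → u ≡ v → (u == v) ≡ true
  ≡⇒== {u} {v} = dec-true (u Fin.≟ v)

  up-root : ∀ j → up j zero ≡ zero
  up-root zero    = refl
  up-root (suc j) = up-root j

  up-suc : ∀ j v → up (suc j) v ≡ par (up j v)
  up-suc zero    v = refl
  up-suc (suc j) v = up-suc j (par v)

  up-+ : ∀ j k v → up (j ℕ.+ k) v ≡ up k (up j v)
  up-+ zero    k v = refl
  up-+ (suc j) k v = up-+ j k (par v)

  up-≤ : ∀ j v → toℕ (up j v) ℕ.≤ toℕ v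
  up-≤ zero    v       = ℕₚ.≤-refl
  up-≤ (suc j) zero    = up-≤ j zero
  up-≤ (suc j) (suc i) = ℕₚ.≤-trans (up-≤ j (parent i)) (ℕₚ.≤-trans (parent< i) (ℕₚ.n≤1+n (toℕ i)))

  up-beyond-depth : ∀ j v → toℕ v ℕ.≤ j → up j v ≡ zero
  up-beyond-depth zero    zero    _         = refl
  up-beyond-depth (suc j) zero    _         = up-root j
  up-beyond-depth (suc j) (suc i) (s≤s i≤j) = up-beyond-depth j (parent i) (ℕₚ.≤-trans (parent< i) i≤j)

  up-suc-fixed⇒root : ∀ j v → up (suc j) v ≡ v → v ≡ zero
  up-suc-fixed⇒root j zero    _ = refl
  up-suc-fixed⇒root j (suc i) e =
    ⊥-elim (ℕₚ.<-irrefl (cong toℕ e) (ℕₚ.≤-<-trans (up-≤ j (parent i)) (s≤s (parent< i))))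

  Anc : V → V → Set
  Anc a v = ∃ λ j → up j v ≡ a

  Anc-refl : ∀ {v} → Anc v v
  Anc-refl = 0 , refl

  Anc-par : ∀ {v} → Anc (par v) v
  Anc-par = 1 , refl

  Anc-trans : ∀ {a b v} → Anc a b → Anc b v → Anc a v
  Anc-trans {v = v} (j , b↑j≡a) (k , v↑k≡b) = k ℕ.+ j , trans (up-+ k j v) (trans (cong (up j) v↑k≡b) b↑j≡a)

  Anc-root : ∀ {a} → Anc a zero → a ≡ zero
  Anc-root (j , e) = trans (sym e) (up-root j)

  Anc-antisym : ∀ {a b} → Anc a b → Anc b a → a ≡ b
  Anc-antisym (zero  , e)  _            = sym e
  Anc-antisym {b = b} (suc j , b↑≡a) (k , a↑≡b)
    with up-suc-fixed⇒root (j ℕ.+ k) b (trans (up-+ (suc j) k b) (trans (cong (up k) b↑≡a) a↑≡b))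
  ... | refl = trans (sym b↑≡a) (up-root (suc j))

  Anc-par⁻ : ∀ {a u} → Anc a u → a ≢ u → Anc a (par u)
  Anc-par⁻ (zero  , e) a≢u = ⊥-elim (a≢u (sym e))
  Anc-par⁻ (suc j , e) _   = j , e

  Anc-child : ∀ {u b} → Anc u b → u ≢ b → u ≢ zero → ∃ λ i → parent i ≡ u × Anc (suc i) b
  Anc-child (zero , e) u≢b _ = ⊥-elim (u≢b (sym e))
  Anc-child {b = b} (suc j , e) _ u≢0 with up j b in b↑j
  ... | zero  = ⊥-elim (u≢0 (trans (sym e) (trans (up-suc j b) (cong par b↑j))))
  ... | suc i = i , trans (cong par (sym b↑j)) (trans (sym (up-suc j b)) e) , j , b↑j

  Anc-bounded : ∀ {a v} → Anc a v → ∃ λ j → j ℕ.≤ n × up j v ≡ a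
  Anc-bounded {v = v} (j , e) with j ℕ.≤? n
  ... | yes j≤n = j , j≤n , e
  ... | no  j≰n =
    n , ℕₚ.≤-refl , trans (up-beyond-depth n v depth≤n) (trans (sym (up-beyond-depth j v depth≤j)) e)
    where
    depth≤n = ℕₚ.≤-pred (Finₚ.toℕ<n v)
    depth≤j = ℕₚ.≤-trans depth≤n (ℕₚ.<⇒≤ (ℕₚ.≰⇒> j≰n))

  anc⇒Anc : ∀ {a v} → anc a v ≡ true → Anc a v
  anc⇒Anc {a} {v} e =
    let j , _ , v↑j==a = any-true⁻ (λ j → up j v == a) (upTo (suc n)) e in j , ==⇒≡ v↑j==a

  Anc⇒anc : ∀ {a v} → Anc a v → anc a v ≡ true
  Anc⇒anc {a} {v} A =
    let j , j≤n , e = Anc-bounded A in any-true⁺ (λ j → up j v == a) (∈-upTo⁺ (s≤s j≤n)) (≡⇒== e)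

  ¬Anc⇒anc : ∀ {a v} → ¬ Anc a v → anc a v ≡ false
  ¬Anc⇒anc {a} {v} ¬A with anc a v in e
  ... | true  = ⊥-elim (¬A (anc⇒Anc e))
  ... | false = refl

  anc≡false⇒¬Anc : ∀ {a v} → anc a v ≡ false → ¬ Anc a v
  anc≡false⇒¬Anc e A = not-¬ e (Anc⇒anc A)

  anc-cong : ∀ {a u b v} → (Anc a u → Anc b v) → (Anc b v → Anc a u) → anc a u ≡ anc b v
  anc-cong {a} {u} {b} {v} to from with anc b v in e
  ... | true  = Anc⇒anc (from (anc⇒Anc e))
  ... | false = ¬Anc⇒anc (anc≡false⇒¬Anc e ∘ to)

  anc-root : ∀ i → anc (suc i) zero ≡ false
  anc-root i = ¬Anc⇒anc (λ A → Finₚ.0≢1+n (sym (Anc-root A)))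

  anc-par : ∀ {a u} → a ≢ u → anc a u ≡ anc a (par u)
  anc-par a≢u = anc-cong (λ a↑u → Anc-par⁻ a↑u a≢u) (λ a↑pu → Anc-trans a↑pu Anc-par)

  ¬Anc-child-parent : ∀ {i} → ¬ Anc (suc i) (parent i)
  ¬Anc-child-parent {i} A = ℕₚ.<-irrefl (cong toℕ (sym (Anc-antisym A Anc-par))) (s≤s (parent< i))

  root-child-above : ∀ u → u ≢ zero → ∃ λ c → IsChild c × Anc c u
  root-child-above u = go (toℕ u) u ℕₚ.≤-refl
    where
    go : ∀ k u → toℕ u ℕ.≤ k → u ≢ zero → ∃ λ c → IsChild c × Anc c u
    go _       zero    _         u≢0 = ⊥-elim (u≢0 refl)
    go zero    (suc i) ()
    go (suc k) (suc i) (s≤s i≤k) _ with parent i Fin.≟ zero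
    ... | yes pᵢ≡0 = suc i , (i , refl , pᵢ≡0) , Anc-refl
    ... | no  pᵢ≢0 = let c , child , c↑ = go k (parent i) (ℕₚ.≤-trans (parent< i) i≤k) pᵢ≢0
                     in c , child , Anc-trans c↑ Anc-par

  sameSub-intro : ∀ {w a b} → w ≢ zero → Anc w a → Anc w b → sameSub a b ≡ true
  sameSub-intro {zero}  w≢0 _   _   = ⊥-elim (w≢0 refl)
  sameSub-intro {suc i} {a} {b} _ w↑a w↑b =
    any-true⁺ (λ w → anc (suc w) a ∧ anc (suc w) b) (∈-allFin i) (cong₂ _∧_ (Anc⇒anc w↑a) (Anc⇒anc w↑b))

  nonCritical : V → Bool
  nonCritical u = nonroot u ∧ not (critB u)

  noncritical-unique-child : ∀ {u} → nonCritical u ≡ true →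
                             ∃ λ w → parent w ≡ u × (∀ {i} → parent i ≡ u → i ≡ w)
  noncritical-unique-child {suc ju} noncrit =
    w , ==⇒≡ pw , λ pi → filter-tabulate-single _ isChild one-child (≡⇒== pi) pw
    where
    isChild : Fin n → Bool
    isChild i = parent i == suc ju
    deg≡2 : deg (suc ju) ≡ 2
    deg≡2 = does-true⇒ (deg (suc ju) ℕ.≟ 2) (trans (sym (not-involutive _)) noncrit)
    one-child : numChildren (suc ju) ≡ 1
    one-child = ℕₚ.suc-injective (trans (ℕₚ.+-comm 1 (numChildren (suc ju))) deg≡2)
    child = filter-tabulate-witness _ isChild (subst (0 ℕ.<_) (sym one-child) (s≤s z≤n))
    w = proj₁ child
    pw = proj₂ child

module CrossLinks {n m : ℕ} (parent : Fin n → Fin (suc n)) (parent< : ParentOK parent)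
                  (lk : Fin m → Fin (suc n) × Fin (suc n)) (shadows : TAP.ShadowComplete parent lk) where

  open TAP parent lk
  open Ancestry parent parent< lk

  p₁ p₂ : Link → V
  p₁ ℓ = proj₁ (lk ℓ)
  p₂ ℓ = proj₂ (lk ℓ)

  Ends : Link → V → V → Set
  Ends ℓ u v = SamePair (lk ℓ) (u , v)

  Ends-sym : ∀ {ℓ u v} → Ends ℓ u v → Ends ℓ v u
  Ends-sym (inj₁ e) = inj₂ e
  Ends-sym (inj₂ e) = inj₁ e

  Ends-endpoint : ∀ {ℓ u v a b} → Ends ℓ u v → Ends ℓ a b → a ≡ u ⊎ a ≡ v
  Ends-endpoint (inj₁ (p₁≡u , _)) (inj₁ (p₁≡a , _)) = inj₁ (trans (sym p₁≡a) p₁≡u)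
  Ends-endpoint (inj₂ (p₁≡v , _)) (inj₁ (p₁≡a , _)) = inj₂ (trans (sym p₁≡a) p₁≡v)
  Ends-endpoint (inj₁ (_ , p₂≡v)) (inj₂ (_ , p₂≡a)) = inj₂ (trans (sym p₂≡a) p₂≡v)
  Ends-endpoint (inj₂ (_ , p₂≡u)) (inj₂ (_ , p₂≡a)) = inj₁ (trans (sym p₂≡a) p₂≡u)

  P-Ends : ∀ {ℓ u v} → Ends ℓ u v → ∀ e → P ℓ e ≡ onPathE u v e
  P-Ends (inj₁ (refl , refl)) e = refl
  P-Ends {ℓ} (inj₂ (refl , refl)) e = xor-comm (anc (suc e) (p₁ ℓ)) (anc (suc e) (p₂ ℓ))

  P-split : ∀ {ℓ i} → P ℓ i ≡ true → ∃₂ λ a b → Ends ℓ a b × Anc (suc i) a × ¬ Anc (suc i) b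
  P-split {ℓ} {i} Pℓi with xor-true⁻ (anc (suc i) (p₁ ℓ)) (anc (suc i) (p₂ ℓ)) Pℓi
  ... | inj₁ (in₁ , out₂) = p₁ ℓ , p₂ ℓ , inj₁ (refl , refl) , anc⇒Anc in₁ , anc≡false⇒¬Anc out₂
  ... | inj₂ (out₁ , in₂) = p₂ ℓ , p₁ ℓ , inj₂ (refl , refl) , anc⇒Anc in₂ , anc≡false⇒¬Anc out₁

  Ends-shadow : ∀ {ℓ s a b} → Ends s a b → OnPathV ℓ a → OnPathV ℓ b → IsShadow s ℓ
  Ends-shadow (inj₁ (refl , refl)) a-on b-on = a-on , b-on
  Ends-shadow (inj₂ (refl , refl)) a-on b-on = b-on , a-on

  Separated : V → V → Set
  Separated u v = ∀ i → Anc (suc i) u → ¬ Anc (suc i) v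

  Separated⇒¬Anc : ∀ {u v} → Separated u v → v ≢ zero → ¬ Anc v u
  Separated⇒¬Anc {v = zero}  _   v≢0 _   = v≢0 refl
  Separated⇒¬Anc {v = suc j} sep _   v↑u = sep j v↑u Anc-refl

  CrossAt : Link → V → V → Set
  CrossAt ℓ u v = Ends ℓ u v × u ≢ zero × v ≢ zero × Separated u v

  CrossAt-sym : ∀ {ℓ u v} → CrossAt ℓ u v → CrossAt ℓ v u
  CrossAt-sym (ends , u≢0 , v≢0 , sep) = Ends-sym ends , v≢0 , u≢0 , λ i v↑ u↑ → sep i u↑ v↑

  nonroot⇒≢zero : ∀ {u} → nonroot u ≡ true → u ≢ zero
  nonroot⇒≢zero {suc _} _ ()

  crossB-nonroot₁ : ∀ {ℓ} → crossB ℓ ≡ true → nonroot (p₁ ℓ) ≡ true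
  crossB-nonroot₁ cross = ∧-conicalˡ _ _ cross

  crossB-nonroot₂ : ∀ {ℓ} → crossB ℓ ≡ true → nonroot (p₂ ℓ) ≡ true
  crossB-nonroot₂ {ℓ} cross = ∧-conicalˡ _ _ (∧-conicalʳ (nonroot (p₁ ℓ)) _ cross)

  crossB⇒CrossAt : ∀ {ℓ} → crossB ℓ ≡ true → CrossAt ℓ (p₁ ℓ) (p₂ ℓ)
  crossB⇒CrossAt {ℓ} cross =
      inj₁ (refl , refl)
    , nonroot⇒≢zero (crossB-nonroot₁ cross)
    , nonroot⇒≢zero (crossB-nonroot₂ cross)
    , λ i u↑ v↑ → not-¬ separated (cong not (sameSub-intro (Finₚ.0≢1+n ∘ sym) u↑ v↑))
    where separated = ∧-conicalʳ (nonroot (p₂ ℓ)) _ (∧-conicalʳ (nonroot (p₁ ℓ)) _ cross)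

  hasEnd : V → Link → Bool
  hasEnd u ℓ = (p₁ ℓ == u) ∨ (p₂ ℓ == u)

  hasEnd-p₁ : ∀ ℓ → hasEnd (p₁ ℓ) ℓ ≡ true
  hasEnd-p₁ ℓ = cong (_∨ (p₂ ℓ == p₁ ℓ)) (≡⇒== {p₁ ℓ} refl)

  hasEnd-p₂ : ∀ ℓ → hasEnd (p₂ ℓ) ℓ ≡ true
  hasEnd-p₂ ℓ = ∨-introʳ (p₁ ℓ == p₂ ℓ) (≡⇒== {p₂ ℓ} refl)

  crossAt : V → Link → Bool
  crossAt u ℓ = crossB ℓ ∧ hasEnd u ℓ

  crossAt⇒CrossAt : ∀ {u ℓ} → crossAt u ℓ ≡ true → ∃ (CrossAt ℓ u)
  crossAt⇒CrossAt {u} {ℓ} e = orient (∨-true⁻ (∧-conicalʳ _ _ e)) (crossB⇒CrossAt (∧-conicalˡ _ _ e))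
    where
    orient : (p₁ ℓ == u) ≡ true ⊎ (p₂ ℓ == u) ≡ true → CrossAt ℓ (p₁ ℓ) (p₂ ℓ) → ∃ (CrossAt ℓ u)
    orient (inj₁ p₁==u) ca = p₂ ℓ , subst (λ w → CrossAt ℓ w (p₂ ℓ)) (==⇒≡ p₁==u) ca
    orient (inj₂ p₂==u) ca = p₁ ℓ , subst (λ w → CrossAt ℓ w (p₁ ℓ)) (==⇒≡ p₂==u) (CrossAt-sym ca)

  cross-edge-above : ∀ {ℓ i v} → CrossAt ℓ (suc i) v → P ℓ i ≡ true
  cross-edge-above {ℓ} {i} (ends , _ , _ , sep)
    rewrite P-Ends ends i | Anc⇒anc (Anc-refl {suc i}) | ¬Anc⇒anc (sep i Anc-refl) = refl

  cross-end-on-path : ∀ {ℓ u v} → CrossAt ℓ u v → OnPathV ℓ u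
  cross-end-on-path {u = zero}  (_ , u≢0 , _) = ⊥-elim (u≢0 refl)
  cross-end-on-path {u = suc i} ca            = i , cross-edge-above ca , inj₁ refl

  cross-parent-on-path : ∀ {ℓ i v} → CrossAt ℓ (suc i) v → OnPathV ℓ (parent i)
  cross-parent-on-path {i = i} ca = i , cross-edge-above ca , inj₂ refl

  cross-root-on-path : ∀ {ℓ u v} → CrossAt ℓ u v → OnPathV ℓ zero
  cross-root-on-path {ℓ} {u} {v} (ends , u≢0 , _ , sep) with root-child-above u u≢0
  ... | _ , (i , refl , pᵢ≡0) , c↑u = i , edge , inj₂ (sym pᵢ≡0)
    where
    edge : P ℓ i ≡ true
    edge rewrite P-Ends ends i | Anc⇒anc c↑u | ¬Anc⇒anc (sep i c↑u) = refl

  Replacement : Link → Link → Set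
  Replacement ℓ₁ ℓ₂ =
    Σ Link λ s → IsShadow s ℓ₁ × s ≢ ℓ₁ × (∀ e → (P ℓ₁ e ∨ P ℓ₂ e) ≡ (P s e ∨ P ℓ₂ e))

  minimal⇒no-replacement : ∀ {D ℓ₁ ℓ₂} → ShadowMinimal D → ℓ₁ ∈ D → ℓ₂ ∈ D →
                           Replacement ℓ₁ ℓ₂ → ℓ₁ ≡ ℓ₂
  minimal⇒no-replacement {ℓ₁ = ℓ₁} {ℓ₂} minimal ℓ₁∈D ℓ₂∈D replacement =
    decidable-stable (ℓ₁ Fin.≟ ℓ₂) (λ ℓ₁≢ℓ₂ → proj₁ (minimal ℓ₁ ℓ₂ ℓ₁∈D ℓ₂∈D ℓ₁≢ℓ₂) replacement)

  move-endpoint : ∀ {ℓ ℓ' u v a} → Ends ℓ u v → OnPathV ℓ a → OnPathV ℓ v → a ≢ u → a ≢ v →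
                  (∀ e → (onPathE u v e ∨ P ℓ' e) ≡ (onPathE a v e ∨ P ℓ' e)) → Replacement ℓ ℓ'
  move-endpoint {ℓ} {ℓ'} {u} {v} {a} ends a-on v-on a≢u a≢v same-union
    with shadows ℓ a v a≢v a-on v-on
  ... | s , s-ends = s , Ends-shadow s-ends a-on v-on , s≢ℓ , union
    where
    s≢ℓ : s ≢ ℓ
    s≢ℓ refl = [ a≢u , a≢v ] (Ends-endpoint ends s-ends)
    union : ∀ e → (P ℓ e ∨ P ℓ' e) ≡ (P s e ∨ P ℓ' e)
    union e rewrite P-Ends ends e | P-Ends s-ends e = same-union e

  -- The shadow r v₁ of ℓ₁ misses only the edges between r and u, and ℓ₂ covers those.
  cross-replacement-at-root : ∀ {ℓ₁ ℓ₂ u v₁ v₂} → CrossAt ℓ₁ u v₁ → CrossAt ℓ₂ u v₂ → Replacement ℓ₁ ℓ₂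
  cross-replacement-at-root {ℓ₁} {ℓ₂} {u} {v₁} ca₁@(ends₁ , u≢0 , v₁≢0 , sep₁) (ends₂ , _ , _ , sep₂) =
    move-endpoint ends₁ (cross-root-on-path ca₁) (cross-end-on-path (CrossAt-sym ca₁))
                  (u≢0 ∘ sym) (v₁≢0 ∘ sym) same-union
    where
    same-union : ∀ e → (onPathE u v₁ e ∨ P ℓ₂ e) ≡ (onPathE zero v₁ e ∨ P ℓ₂ e)
    same-union e rewrite P-Ends ends₂ e | anc-root e with anc (suc e) u in e↑u
    ... | false = refl
    ... | true rewrite ¬Anc⇒anc (sep₁ e (anc⇒Anc e↑u)) | ¬Anc⇒anc (sep₂ e (anc⇒Anc e↑u)) = refl

  -- The shadow (parent u) v of ℓ misses only the edge above u.
  cross-replacement-at-parent : ∀ {ℓ ℓ' i v} → CrossAt ℓ (suc i) v → P ℓ' i ≡ true → Replacement ℓ ℓ'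
  cross-replacement-at-parent {ℓ} {ℓ'} {i} {v} ca@(ends , _ , v≢0 , sep) P'ᵢ =
    move-endpoint ends (cross-parent-on-path ca) (cross-end-on-path (CrossAt-sym ca))
                  pᵢ≢u pᵢ≢v same-union
    where
    pᵢ≢u : parent i ≢ suc i
    pᵢ≢u e = ℕₚ.<-irrefl (cong toℕ e) (s≤s (parent< i))
    pᵢ≢v : parent i ≢ v
    pᵢ≢v pᵢ≡v = Separated⇒¬Anc sep v≢0 (subst (λ w → Anc w (suc i)) pᵢ≡v Anc-par)
    same-union : ∀ e → (onPathE (suc i) v e ∨ P ℓ' e) ≡ (onPathE (parent i) v e ∨ P ℓ' e)
    same-union e with e Fin.≟ i
    ... | yes refl rewrite P'ᵢ = trans (∨-zeroʳ _) (sym (∨-zeroʳ _))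
    ... | no  e≢i  rewrite anc-par {suc e} {suc i} (e≢i ∘ Finₚ.suc-injective) = refl

  cross-unique : ∀ {D} → ShadowMinimal D → ∀ {ℓ₁ ℓ₂ u v₁ v₂} → ℓ₁ ∈ D → ℓ₂ ∈ D →
                 CrossAt ℓ₁ u v₁ → CrossAt ℓ₂ u v₂ → ℓ₁ ≡ ℓ₂
  cross-unique minimal ℓ₁∈D ℓ₂∈D ca₁ ca₂ =
    minimal⇒no-replacement minimal ℓ₁∈D ℓ₂∈D (cross-replacement-at-root ca₁ ca₂)

  top : Link → V
  top ℓ = if anc (p₁ ℓ) (p₂ ℓ) then p₁ ℓ else p₂ ℓ

  upAt : V → Link → Bool
  upAt u ℓ = upB ℓ ∧ (top ℓ == u)

  top-above : ∀ {ℓ} → upB ℓ ≡ true → ∃ λ b → Ends ℓ (top ℓ) b × Anc (top ℓ) b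
  top-above {ℓ} up with anc (p₁ ℓ) (p₂ ℓ) in p₁↑p₂
  ... | true  = p₂ ℓ , inj₁ (refl , refl) , anc⇒Anc p₁↑p₂
  ... | false = p₁ ℓ , inj₂ (refl , refl) , anc⇒Anc (∧-conicalʳ _ _ up)

  inB-intro : ∀ {ℓ} → sameSub (p₁ ℓ) (p₂ ℓ) ≡ true → inB ℓ ≡ true
  inB-intro {ℓ} same = ∨-introʳ (not (nonroot (p₁ ℓ))) (∨-introʳ (not (nonroot (p₂ ℓ))) same)

  upAt-intro : ∀ {ℓ a u} → Ends ℓ a u → u ≢ zero → Anc u a → a ≢ u → upAt u ℓ ≡ true
  upAt-intro {ℓ} (inj₁ (refl , refl)) u≢0 u↑a a≢u =
    cong₂ _∧_
      (cong₂ _∧_ (inB-intro (sameSub-intro u≢0 u↑a Anc-refl)) (∨-introʳ (anc (p₁ ℓ) (p₂ ℓ)) (Anc⇒anc u↑a)))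
      (≡⇒== (cong (λ b → if b then p₁ ℓ else p₂ ℓ) (¬Anc⇒anc (λ a↑u → a≢u (Anc-antisym a↑u u↑a)))))
  upAt-intro {ℓ} (inj₂ (refl , refl)) u≢0 u↑a a≢u =
    cong₂ _∧_
      (cong₂ _∧_ (inB-intro (sameSub-intro u≢0 Anc-refl u↑a)) (cong (_∨ anc (p₂ ℓ) (p₁ ℓ)) (Anc⇒anc u↑a)))
      (≡⇒== (cong (λ b → if b then p₁ ℓ else p₂ ℓ) (Anc⇒anc u↑a)))

  cross-covered : ∀ {c ℓ i v} → Anc c (suc i) → CrossAt ℓ (suc i) v → InCov c ℓ
  cross-covered {i = i} c↑u ca = i , cross-edge-above ca , Anc⇒anc c↑u

  below-covered : ∀ {c ℓ u b} → Anc c u → Ends ℓ u b → Anc u b → b ≢ u → InCov c ℓ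
  below-covered {b = zero}  _   _    u↑b b≢u = ⊥-elim (b≢u (sym (Anc-root u↑b)))
  below-covered {c} {ℓ} {u} {suc j} c↑u ends u↑b b≢u = j , edge , Anc⇒anc (Anc-trans c↑u u↑b)
    where
    edge : P ℓ j ≡ true
    edge rewrite P-Ends ends j | ¬Anc⇒anc (λ b↑u → b≢u (Anc-antisym b↑u u↑b)) | Anc⇒anc (Anc-refl {suc j})
      = refl

  module _ {ju w : Fin n} (pw≡u : parent w ≡ suc ju) (only-child : ∀ {i} → parent i ≡ suc ju → i ≡ w) where

    cross-avoids-child-edge : ∀ {ℓ v} → CrossAt ℓ (suc ju) v → P ℓ w ≡ false
    cross-avoids-child-edge {ℓ} {v} (ends , _ , _ , sep)
      rewrite P-Ends ends w
            | ¬Anc⇒anc (¬Anc-child-parent ∘ subst (Anc (suc w)) (sym pw≡u))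
            | ¬Anc⇒anc (sep ju Anc-refl ∘ Anc-trans (1 , pw≡u)) = refl

    leaving-child-subtree : ∀ {ℓ a b} → Ends ℓ a b → Anc (suc w) a → ¬ Anc (suc w) b →
                            upAt (suc ju) ℓ ≡ true ⊎ P ℓ ju ≡ true
    leaving-child-subtree {ℓ} {a} {b} ends w↑a ¬w↑b with b Fin.≟ suc ju
    ... | yes refl = inj₁ (upAt-intro ends (λ ()) u↑a a≢u)
      where
      u↑a = Anc-trans (1 , pw≡u) w↑a
      a≢u : a ≢ suc ju
      a≢u a≡u = ¬Anc-child-parent (subst (Anc (suc w)) (trans a≡u (sym pw≡u)) w↑a)
    ... | no b≢u = inj₂ edge
      where
      ¬u↑b : ¬ Anc (suc ju) b
      ¬u↑b u↑b with Anc-child u↑b (b≢u ∘ sym) (λ ())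
      ... | i , pᵢ≡u , i↑b rewrite only-child pᵢ≡u = ¬w↑b i↑b
      edge : P ℓ ju ≡ true
      edge rewrite P-Ends ends ju | Anc⇒anc (Anc-trans (1 , pw≡u) w↑a) | ¬Anc⇒anc ¬u↑b = refl

    up-link-at : ∀ {D} → ShadowMinimal D → ∀ {c} → Anc c (suc ju) →
                 (∀ i → inE c i ≡ true → Σ Link λ ℓ → ℓ ∈ D × P ℓ i ≡ true) →
                 ∀ {ℓ v} → ℓ ∈ D → CrossAt ℓ (suc ju) v → ∃ λ ℓ' → ℓ' ∈ D × upAt (suc ju) ℓ' ≡ true
    up-link-at minimal c↑u covers ℓ∈D ca with covers w (Anc⇒anc (Anc-trans c↑u (1 , pw≡u)))
    ... | ℓ' , ℓ'∈D , P'w with P-split P'w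
    ... | _ , _ , ends' , w↑a , ¬w↑b with leaving-child-subtree ends' w↑a ¬w↑b
    ... | inj₁ up  = ℓ' , ℓ'∈D , up
    ... | inj₂ P'u with minimal⇒no-replacement minimal ℓ∈D ℓ'∈D (cross-replacement-at-parent ca P'u)
    ... | refl = ⊥-elim (not-¬ (cross-avoids-child-edge ca) P'w)

module Charging {n m : ℕ} (parent : Fin n → Fin (suc n)) (parent< : ParentOK parent)
                     (lk : Fin m → Fin (suc n) × Fin (suc n)) (links-ok : LinksOK lk)
                     (shadows : TAP.ShadowComplete parent lk)
                     (C : Fin (suc n) → Subset m → Subset m) (C-choice : TAP.IsCChoice parent lk C)
                     (x : Fin m → ℚ) (lam : Fin (suc n) → Subset m → ℚ)
                     (feasible : TAP.Feasible parent lk C x lam) where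

  open TAP parent lk
  open Ancestry parent parent< lk
  open CrossLinks parent parent< lk shadows
  open Feasible feasible
  open ≤-Reasoning

  x-nonneg : ∀ ℓ → 0ℚ ≤ x ℓ
  x-nonneg ℓ = proj₁ (proj₁ cg ℓ)

  xsum-nonneg : ∀ p → 0ℚ ≤ xsum x p
  xsum-nonneg p = sumFin-nonneg (λ ℓ → when-nonneg (p ℓ) (x-nonneg ℓ))

  Ends-distinct : ∀ {ℓ a b} → Ends ℓ a b → a ≢ b
  Ends-distinct {ℓ} (inj₁ (p₁≡a , p₂≡b)) a≡b = proj₁ links-ok ℓ (trans p₁≡a (trans a≡b (sym p₂≡b)))
  Ends-distinct {ℓ} (inj₂ (p₁≡b , p₂≡a)) a≡b = proj₁ links-ok ℓ (trans p₁≡b (trans (sym a≡b) (sym p₂≡a)))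

  up-covered : ∀ {c u ℓ} → Anc c u → upAt u ℓ ≡ true → InCov c ℓ
  up-covered {c} {u} {ℓ} c↑u up with top-above (∧-conicalˡ _ _ up)
  ... | b , ends , top↑b = below-covered (subst (Anc c) (sym (==⇒≡ (∧-conicalʳ _ _ up))) c↑u)
                                         ends top↑b (Ends-distinct ends ∘ sym)

  inL : V → Subset m → Link → Bool
  inL c R ℓ = memB ℓ (R ∪ C c R)

  x-decomposition : ∀ {c} → IsChild c → (p : Link → Bool) → (∀ {ℓ} → p ℓ ≡ true → InCov c ℓ) →
                    xsum x p ≡ sumSubsets m (λ R → sumFin m (λ ℓ → when (p ℓ ∧ inL c R ℓ) (lam c R)))
  x-decomposition {c} child p covered =
    trans (sumFin-cong per-link) (sumFin-sumSubsets-comm (λ ℓ R → when (p ℓ ∧ inL c R ℓ) (lam c R)))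
    where
    per-link : ∀ ℓ → when (p ℓ) (x ℓ) ≡ sumSubsets m (λ R → when (p ℓ ∧ inL c R ℓ) (lam c R))
    per-link ℓ with p ℓ in pℓ
    ... | true  = lamCons c child ℓ (covered pℓ)
    ... | false = sym (sumSubsets-zero {m} (λ _ → refl))

  module _ {ju c} (noncrit : nonCritical (suc ju) ≡ true) (child : IsChild c) (c↑u : Anc c (suc ju)) where

    cross≤up-for : ∀ R → sumFin m (λ ℓ → when (crossAt (suc ju) ℓ ∧ inL c R ℓ) (lam c R))
                       ≤ sumFin m (λ ℓ → when (upAt (suc ju) ℓ ∧ inL c R ℓ) (lam c R))
    -- InΛ c R is undecidable but the inequality is decidable: if it failed, λ_c^R ≠ 0, so R ∈ Λ_c.
    cross≤up-for R = decidable-stable (_ ≤? _) (λ ≰ → ≰ (weightless (lamSupp c R (≰ ∘ in-Λ))))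
      where
      q q' : Link → Bool
      q  ℓ = crossAt (suc ju) ℓ ∧ inL c R ℓ
      q' ℓ = upAt (suc ju) ℓ ∧ inL c R ℓ

      weightless : lam c R ≡ 0ℚ →
                   sumFin m (λ ℓ → when (q ℓ) (lam c R)) ≤ sumFin m (λ ℓ → when (q' ℓ) (lam c R))
      weightless lam≡0 rewrite lam≡0 =
        ≤-reflexive (trans (sumFin-zero (when-zero ∘ q)) (sym (sumFin-zero (when-zero ∘ q'))))

      in-Λ : InΛ c R → sumFin m (λ ℓ → when (q ℓ) (lam c R)) ≤ sumFin m (λ ℓ → when (q' ℓ) (lam c R))
      in-Λ inΛ = sumFin-when-compare q q' (lamNonneg c R) unique exists
        where
        minimal = proj₁ (proj₂ (proj₁ (C-choice c child R inΛ)))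
        covers  = proj₂ (proj₂ (proj₁ (C-choice c child R inΛ)))
        in-L : ∀ {ℓ} → q ℓ ≡ true → ℓ ∈ R ∪ C c R
        in-L {ℓ} qℓ = lookup⇒[]= ℓ (R ∪ C c R) (∧-conicalʳ _ _ qℓ)
        cross : ∀ {ℓ} → q ℓ ≡ true → ∃ (CrossAt ℓ (suc ju))
        cross qℓ = crossAt⇒CrossAt (∧-conicalˡ _ _ qℓ)
        unique : ∀ {ℓ₁ ℓ₂} → q ℓ₁ ≡ true → q ℓ₂ ≡ true → ℓ₁ ≡ ℓ₂
        unique q₁ q₂ =
          cross-unique minimal (in-L q₁) (in-L q₂) (proj₂ (cross q₁)) (proj₂ (cross q₂))
        exists : ∀ {ℓ} → q ℓ ≡ true → ∃ λ ℓ' → q' ℓ' ≡ true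
        exists qℓ with noncritical-unique-child noncrit
        ... | w , pw≡u , only-child
          with up-link-at pw≡u only-child minimal c↑u covers (in-L qℓ) (proj₂ (cross qℓ))
        ... | ℓ' , ℓ'∈L , up = ℓ' , cong₂ _∧_ up ([]=⇒lookup ℓ'∈L)

  cross≤up-at : ∀ {u} → nonCritical u ≡ true → xsum x (crossAt u) ≤ xsum x (upAt u)
  cross≤up-at {zero}   ()
  cross≤up-at {suc ju} noncrit with root-child-above (suc ju) (λ ())
  ... | c , child , c↑u = begin
    xsum x (crossAt (suc ju))
      ≡⟨ x-decomposition child (crossAt (suc ju)) (λ e → cross-covered c↑u (proj₂ (crossAt⇒CrossAt e))) ⟩
    sumSubsets m (λ R → sumFin m (λ ℓ → when (crossAt (suc ju) ℓ ∧ inL c R ℓ) (lam c R)))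
      ≤⟨ sumSubsets-mono (cross≤up-for noncrit child c↑u) ⟩
    sumSubsets m (λ R → sumFin m (λ ℓ → when (upAt (suc ju) ℓ ∧ inL c R ℓ) (lam c R)))
      ≡⟨ sym (x-decomposition child (upAt (suc ju)) (up-covered c↑u)) ⟩
    xsum x (upAt (suc ju)) ∎

  crossNoCrit≤crossAt :
    xsum x crossNoCritB ≤ sumFin (suc n) (λ u → when (nonCritical u) (xsum x (crossAt u)))
  crossNoCrit≤crossAt = begin
    xsum x crossNoCritB
      ≤⟨ sumFin-mono per-link ⟩
    sumFin m (λ ℓ → sumFin (suc n) (λ u → when (nonCritical u ∧ crossAt u ℓ) (x ℓ)))
      ≡⟨ sumFin-comm (λ ℓ u → when (nonCritical u ∧ crossAt u ℓ) (x ℓ)) ⟩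
    sumFin (suc n) (λ u → sumFin m (λ ℓ → when (nonCritical u ∧ crossAt u ℓ) (x ℓ)))
      ≡⟨ sumFin-cong (λ u → sumFin-when-∧ (nonCritical u) (λ ℓ → crossAt u ℓ) x) ⟩
    sumFin (suc n) (λ u → when (nonCritical u) (xsum x (crossAt u))) ∎
    where
    per-link : ∀ ℓ → when (crossNoCritB ℓ) (x ℓ)
                   ≤ sumFin (suc n) (λ u → when (nonCritical u ∧ crossAt u ℓ) (x ℓ))
    per-link ℓ with crossNoCritB ℓ in e
    ... | false = sumFin-nonneg (λ u → when-nonneg (nonCritical u ∧ crossAt u ℓ) (x-nonneg ℓ))
    ... | true  = counted (∨-true⁻ (∧-conicalʳ (crossB ℓ) _ e))
      where
      cross : crossB ℓ ≡ true
      cross = ∧-conicalˡ _ (not (critB (p₁ ℓ)) ∨ not (critB (p₂ ℓ))) e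
      counted : not (critB (p₁ ℓ)) ≡ true ⊎ not (critB (p₂ ℓ)) ≡ true →
                x ℓ ≤ sumFin (suc n) (λ u → when (nonCritical u ∧ crossAt u ℓ) (x ℓ))
      counted (inj₁ noncrit₁) = ≤-sumFin-when (λ u → nonCritical u ∧ crossAt u ℓ) (x-nonneg ℓ) {p₁ ℓ}
        (cong₂ _∧_ (cong₂ _∧_ (crossB-nonroot₁ cross) noncrit₁) (cong₂ _∧_ cross (hasEnd-p₁ ℓ)))
      counted (inj₂ noncrit₂) = ≤-sumFin-when (λ u → nonCritical u ∧ crossAt u ℓ) (x-nonneg ℓ) {p₂ ℓ}
        (cong₂ _∧_ (cong₂ _∧_ (crossB-nonroot₂ cross) noncrit₂) (cong₂ _∧_ cross (hasEnd-p₂ ℓ)))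

  crossAt≤upAt : ∀ u → when (nonCritical u) (xsum x (crossAt u)) ≤ xsum x (upAt u)
  crossAt≤upAt u with nonCritical u in noncrit
  ... | true  = cross≤up-at noncrit
  ... | false = xsum-nonneg (upAt u)

  upAt≤up : sumFin (suc n) (λ u → xsum x (upAt u)) ≤ xsum x upB
  upAt≤up = begin
    sumFin (suc n) (λ u → xsum x (upAt u))
      ≡⟨ sumFin-comm (λ u ℓ → when (upAt u ℓ) (x ℓ)) ⟩
    sumFin m (λ ℓ → sumFin (suc n) (λ u → when (upAt u ℓ) (x ℓ)))
      ≤⟨ sumFin-mono per-link ⟩
    xsum x upB ∎
    where
    per-link : ∀ ℓ → sumFin (suc n) (λ u → when (upB ℓ ∧ (top ℓ == u)) (x ℓ)) ≤ when (upB ℓ) (x ℓ)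
    per-link ℓ with upB ℓ
    ... | true  = sumFin-when-≤ (λ u → top ℓ == u) (x-nonneg ℓ)
                                (λ t₁ t₂ → trans (sym (==⇒≡ {top ℓ} t₁)) (==⇒≡ t₂))
    ... | false = ≤-reflexive (sumFin-zero {suc n} (λ _ → refl))

lemma4 : (n m : ℕ) (parent : Fin n → Fin (suc n)) → ParentOK parent →
         (lk : Fin m → Fin (suc n) × Fin (suc n)) → LinksOK lk →
         TAP.ShadowComplete parent lk →
         (k : ℕ) → TAP.KWide parent lk k →
         (C : Fin (suc n) → Subset m → Subset m) → TAP.IsCChoice parent lk C →
         (x : Fin m → ℚ) (lam : Fin (suc n) → Subset m → ℚ) →
         TAP.Feasible parent lk C x lam →
         TAP.xsum parent lk x (TAP.crossNoCritB parent lk) ≤ TAP.xsum parent lk x (TAP.upB parent lk)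
lemma4 n m parent parent< lk links-ok shadows _ _ C C-choice x lam feasible = begin
  xsum x crossNoCritB                                               ≤⟨ crossNoCrit≤crossAt ⟩
  sumFin (suc n) (λ u → when (nonCritical u) (xsum x (crossAt u)))  ≤⟨ sumFin-mono crossAt≤upAt ⟩
  sumFin (suc n) (λ u → xsum x (upAt u))                             ≤⟨ upAt≤up ⟩
  xsum x upB                                                         ∎
  where
  open TAP parent lk
  open Ancestry parent parent< lk using (nonCritical)
  open CrossLinks parent parent< lk shadows using (crossAt; upAt)
  open Charging parent parent< lk links-ok shadows C C-choice x lam feasible
  open ≤-Reasoning
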